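{- Let $3 \le p \le q$ and let $D$ be a strong orientation of $K(3,p,q)$ with parts $V_1=\{x_1,x_2,x_3\}$, $V_2$ ($|V_2|=p$), $V_3$ ($|V_3|=q$). If exactly one of the eight sets $V_2^A$ ($A \subseteq \{1,2,3\}$) is nonempty, then $\mathrm{diam}(D) \ge 3$.
   Context: $K(3,p,q)$ is the complete tripartite graph with parts $V_1=\{x_1,x_2,x_3\}$, $V_2$ of size $p$, $V_3$ of size $q$. A strong orientation is an orientation of all edges making the digraph strongly connected; $\mathrm{diam}(D)$ is the maximum directed distance between ordered pairs of vertices. Write $u\to v$ if the edge $uv$ is oriented from $u$ to $v$. For $A \subseteq [3]=\{1,2,3\}$, let $N_D^A$ be the set of vertices $w$ such that $x_i \to w$ for all $i \in A$ and $w \to x_j$ for all $j \in [3]\setminus A$ (so $N_D^{[3]}$ is the set of common out-neighbours of $x_1,x_2,x_3$ and $N_D^{\emptyset}$ the set of common in-neighbours), and $V_2^A = V_2 \cap N_D^A$. The eight sets $V_2^A$ partition $V_2$. -}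

module Defs where

open import Data.Nat using (ℕ; zero; suc; _≤_)
open import Data.Fin using (Fin)
open import Data.Empty using (⊥)
open import Data.Bool using (Bool; true; false)
open import Data.Product using (Σ; ∃; _×_; _,_)
open import Data.Fin.Subset using (Subset; _∈_; _∉_)
open import Relation.Binary.PropositionalEquality using (_≡_)
open import Relation.Nullary using (¬_)

data Vertex (p q : ℕ) : Set where
  v₁ : Fin 3 → Vertex p q
  v₂ : Fin p → Vertex p q
  v₃ : Fin q → Vertex p q

-- An orientation of K(3,p,q): every edge between distinct parts gets a direction.
-- o₁₂ i a ≡ true  means  x_i → a  (false means a → x_i), etc.
record Orientation (p q : ℕ) : Set where
  field
    o₁₂ : Fin 3 → Fin p → Bool
    o₁₃ : Fin 3 → Fin q → Bool
    o₂₃ : Fin p → Fin q → Bool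
open Orientation public

Arc : ∀ {p q} → Orientation p q → Vertex p q → Vertex p q → Set
Arc D (v₁ i) (v₂ a) = o₁₂ D i a ≡ true
Arc D (v₂ a) (v₁ i) = o₁₂ D i a ≡ false
Arc D (v₁ i) (v₃ b) = o₁₃ D i b ≡ true
Arc D (v₃ b) (v₁ i) = o₁₃ D i b ≡ false
Arc D (v₂ a) (v₃ b) = o₂₃ D a b ≡ true
Arc D (v₃ b) (v₂ a) = o₂₃ D a b ≡ false
Arc D (v₁ _) (v₁ _) = ⊥
Arc D (v₂ _) (v₂ _) = ⊥
Arc D (v₃ _) (v₃ _) = ⊥

data Walk {p q} (D : Orientation p q) : ℕ → Vertex p q → Vertex p q → Set where
  here : ∀ {u} → Walk D zero u u
  step : ∀ {k u v w} → Arc D u v → Walk D k v w → Walk D (suc k) u w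

Strong : ∀ {p q} → Orientation p q → Set
Strong D = ∀ u v → ∃ λ k → Walk D k u v

DistAtLeast : ∀ {p q} → Orientation p q → ℕ → Vertex p q → Vertex p q → Set
DistAtLeast D m u v = ∀ k → suc k ≤ m → ¬ Walk D k u v

DiamAtLeast : ∀ {p q} → Orientation p q → ℕ → Set
DiamAtLeast D m = ∃ λ u → ∃ λ v → DistAtLeast D m u v

InN : ∀ {p q} → Orientation p q → Subset 3 → Vertex p q → Set
InN D A w = ∀ i → (i ∈ A → Arc D (v₁ i) w) × (i ∉ A → Arc D w (v₁ i))

V₂NonEmpty : ∀ {p q} → Orientation p q → Subset 3 → Set
V₂NonEmpty {p} D A = ∃ λ (a : Fin p) → InN D A (v₂ a)

ExactlyOneV₂ : ∀ {p q} → Orientation p q → Set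
ExactlyOneV₂ D = Σ (Subset 3) λ A → V₂NonEmpty D A × (∀ B → V₂NonEmpty D B → B ≡ A)

{-# OPTIONS --safe #-}
module Submission where

-- If only one set V₂^A is nonempty, every vertex of V₂ sees x₁, x₂, x₃
-- according to the same pattern A, so two of them, x_j and x_k, relate to V₂ in the same
-- way; say both dominate V₂ (the other case is dual). If x_j has an out-neighbour c in V₃,
-- then no out-neighbour of c reaches x_j in one step, so dist(c, x_j) ≥ 3. Otherwise all
-- out-neighbours of x_j lie in V₂, none of which reaches x_k, so dist(x_j, x_k) ≥ 3.

open import Defs
open import Data.Nat using (ℕ; _≤_; suc; s≤s)
open import Data.Fin using (Fin)
open import Data.Fin.Patterns using (0F; 1F; 2F)
open import Data.Fin.Properties using (any?)
open import Data.Fin.Subset using (Subset)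
open import Data.Bool using (Bool; true; false; _≟_)
open import Data.Bool.Properties using (not-¬; ¬-not)
open import Data.Product using (_×_; _,_; ∃₂)
open import Data.Vec using (_∷_; []; lookup; tabulate)
open import Data.Vec.Properties using (lookup∘tabulate; []=⇒lookup; lookup⇒[]=)
open import Relation.Nullary using (¬_; yes; no)
open import Relation.Binary.PropositionalEquality using (_≡_; _≢_; refl; sym; trans; cong)

module _ {p q : ℕ} {D : Orientation p q} where

  distAtLeast-3 : ∀ {u v} → u ≢ v → ¬ Arc D u v →
                  (∀ w → Arc D u w → ¬ Arc D w v) → DistAtLeast D 3 u v
  distAtLeast-3 u≢v _   _     0 _ here                     = u≢v refl
  distAtLeast-3 _   ¬uv _     1 _ (step uv here)           = ¬uv uv
  distAtLeast-3 _   _   noMid 2 _ (step uw (step wv here)) = noMid _ uw wv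
  distAtLeast-3 _   _   _     (suc (suc (suc _))) (s≤s (s≤s (s≤s ()))) _

  v₁-injective-≢ : ∀ {j k} → j ≢ k → v₁ {p} {q} j ≢ v₁ k
  v₁-injective-≢ j≢k refl = j≢k refl

  dominating-pair⇒diam≥3 : ∀ {j k} → j ≢ k →
    (∀ a → Arc D (v₁ j) (v₂ a)) → (∀ a → Arc D (v₁ k) (v₂ a)) → DiamAtLeast D 3
  dominating-pair⇒diam≥3 {j} {k} j≢k j⇒V₂ k⇒V₂ with any? (λ c → o₁₃ D j c ≟ true)
  ... | yes (c , j→c) = v₃ c , v₁ j , distAtLeast-3 (λ ()) (not-¬ j→c) noMid
    where
    noMid : ∀ w → Arc D (v₃ c) w → ¬ Arc D w (v₁ j)
    noMid (v₁ _) _ ()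
    noMid (v₂ a) _ a→j = not-¬ (j⇒V₂ a) a→j
    noMid (v₃ _) ()
  ... | no ¬j→V₃ = v₁ j , v₁ k , distAtLeast-3 (v₁-injective-≢ j≢k) (λ ()) noMid
    where
    noMid : ∀ w → Arc D (v₁ j) w → ¬ Arc D w (v₁ k)
    noMid (v₁ _) ()
    noMid (v₂ a) _ a→k = not-¬ (k⇒V₂ a) a→k
    noMid (v₃ c) j→c _ = ¬j→V₃ (c , j→c)

  dominated-pair⇒diam≥3 : ∀ {j k} → j ≢ k →
    (∀ a → Arc D (v₂ a) (v₁ j)) → (∀ a → Arc D (v₂ a) (v₁ k)) → DiamAtLeast D 3
  dominated-pair⇒diam≥3 {j} {k} j≢k V₂⇒j V₂⇒k with any? (λ c → o₁₃ D k c ≟ false)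
  ... | yes (c , c→k) = v₁ k , v₃ c , distAtLeast-3 (λ ()) (not-¬ c→k) noMid
    where
    noMid : ∀ w → Arc D (v₁ k) w → ¬ Arc D w (v₃ c)
    noMid (v₁ _) ()
    noMid (v₂ a) k→a _ = not-¬ (V₂⇒k a) k→a
    noMid (v₃ _) _ ()
  ... | no ¬V₃→k = v₁ j , v₁ k , distAtLeast-3 (v₁-injective-≢ j≢k) (λ ()) noMid
    where
    noMid : ∀ w → Arc D (v₁ j) w → ¬ Arc D w (v₁ k)
    noMid (v₁ _) ()
    noMid (v₂ a) j→a _ = not-¬ (V₂⇒j a) j→a
    noMid (v₃ c) _ c→k = ¬V₃→k (c , c→k)

  twins-in-V₁⇒diam≥3 : ∀ {j k} → j ≢ k → (b : Bool) →
    (∀ a → o₁₂ D j a ≡ b) → (∀ a → o₁₂ D k a ≡ b) → DiamAtLeast D 3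
  twins-in-V₁⇒diam≥3 j≢k true  = dominating-pair⇒diam≥3 j≢k
  twins-in-V₁⇒diam≥3 j≢k false = dominated-pair⇒diam≥3 j≢k

  profile : Fin p → Subset 3
  profile a = tabulate (λ i → o₁₂ D i a)

  lookup-profile : ∀ a i → lookup (profile a) i ≡ o₁₂ D i a
  lookup-profile a = lookup∘tabulate (λ i → o₁₂ D i a)

  v₂∈N-profile : ∀ a → InN D (profile a) (v₂ a)
  v₂∈N-profile a i =
      (λ i∈ → trans (sym (lookup-profile a i)) ([]=⇒lookup i∈))
    , (λ i∉ → ¬-not (λ i→a → i∉ (lookup⇒[]= i (profile a) (trans (lookup-profile a i) i→a))))

  exactlyOne⇒o₁₂-constant : (A : Subset 3) → (∀ B → V₂NonEmpty D B → B ≡ A) →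
                             ∀ i a → o₁₂ D i a ≡ lookup A i
  exactlyOne⇒o₁₂-constant A unique i a =
    trans (sym (lookup-profile a i))
          (cong (λ B → lookup B i) (unique (profile a) (a , v₂∈N-profile a)))

pigeonhole-Subset3 : (A : Subset 3) → ∃₂ λ j k → j ≢ k × lookup A j ≡ lookup A k
pigeonhole-Subset3 (false ∷ false ∷ _     ∷ []) = 0F , 1F , (λ ()) , refl
pigeonhole-Subset3 (true  ∷ true  ∷ _     ∷ []) = 0F , 1F , (λ ()) , refl
pigeonhole-Subset3 (false ∷ true  ∷ false ∷ []) = 0F , 2F , (λ ()) , refl
pigeonhole-Subset3 (true  ∷ false ∷ true  ∷ []) = 0F , 2F , (λ ()) , refl
pigeonhole-Subset3 (false ∷ true  ∷ true  ∷ []) = 1F , 2F , (λ ()) , refl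
pigeonhole-Subset3 (true  ∷ false ∷ false ∷ []) = 1F , 2F , (λ ()) , refl

theorem4p3 : (p q : ℕ) → 3 ≤ p → p ≤ q → (D : Orientation p q) →
    Strong D → ExactlyOneV₂ D → DiamAtLeast D 3
theorem4p3 p q _ _ D _ (A , _ , unique) with pigeonhole-Subset3 A
... | j , k , j≢k , Aj≡Ak =
  twins-in-V₁⇒diam≥3 j≢k (lookup A j) (o₁₂-constant j)
                                      (λ a → trans (o₁₂-constant k a) (sym Aj≡Ak))
  where
  o₁₂-constant : ∀ i a → o₁₂ D i a ≡ lookup A i
  o₁₂-constant = exactlyOne⇒o₁₂-constant {D = D} A unique
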